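{- Let $0 \leq w < n$ be integers and suppose $\mathcal F \subset 2^{[n]}$ is $w$-union. Then: (i) if $w = 2\ell$, then $\|\mathcal F\|_n \leq \ell + 1$; (ii) if $w = 2\ell - 1$, then $\|\mathcal F\|_n \leq \ell + \frac{\ell}{n}$.
   Context: $[n]=\{1,\dots,n\}$. For $\mathcal F \subset 2^{[n]}$ the binomial norm is $\|\mathcal F\|_n = \sum_{F \in \mathcal F} 1\big/\binom{n}{|F|}$. A family $\mathcal F$ is $w$-union if $|F \cup F'| \leq w$ for all $F, F' \in \mathcal F$. -}

module Defs where

open import Data.Nat using (ℕ; zero; suc; _≤_; z≤n; s≤s; NonZero; >-nonZero; >-nonZero⁻¹; _<_)
open import Data.Nat.Properties using (<-≤-trans; m≤m+n)
open import Data.Nat.Combinatorics using (_C_; nCk+nC[k+1]≡[n+1]C[k+1])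
open import Data.Fin.Subset using (Subset; ∣_∣; _∪_)
open import Data.Fin.Subset.Properties using (∣p∣≤n)
open import Data.List using (List)
open import Data.List.Relation.Unary.All using (All)
open import Data.Integer using (+_)
open import Data.Rational using (ℚ; _/_; 0ℚ; _+_)
open import Relation.Binary.PropositionalEquality using (subst)

C-nonZero : ∀ {n k} → k ≤ n → NonZero (n C k)
C-nonZero {n} {zero} _ = _
C-nonZero {suc n} {suc k} (s≤s k≤n) =
  >-nonZero (subst (0 <_) (nCk+nC[k+1]≡[n+1]C[k+1] n k)
    (<-≤-trans (>-nonZero⁻¹ (n C k) {{C-nonZero k≤n}}) (m≤m+n (n C k) (n C suc k))))

binomWeight : ∀ {n} → Subset n → ℚ
binomWeight {n} F = (+ 1 / (n C ∣ F ∣)) {{C-nonZero (∣p∣≤n F)}}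

-- a family F ⊆ 2^[n] is represented by a duplicate-free list of subsets
-- binomial norm ‖F‖ₙ = Σ_{F ∈ F} 1 / binom(n, |F|)
binomNorm : ∀ {n} → List (Subset n) → ℚ
binomNorm List.[] = 0ℚ
binomNorm (F List.∷ 𝓕) = binomWeight F + binomNorm 𝓕

IsUnion : ∀ {n} → ℕ → List (Subset n) → Set
IsUnion w 𝓕 = All (λ F → All (λ F' → ∣ F ∪ F' ∣ ≤ w) 𝓕) 𝓕

-- Katona's permutation method. A family member F is carried onto a fixed set of
-- size |F| by exactly |F|! (n − |F|)! permutations of [n], so n! ‖𝓕‖ₙ counts the pairs
-- (π, F) for which π F lies in a chain of reference sets W₀, …, W_w with |W_s| = s:
-- W_s = [0, s) when 2 s ≤ w and W_s = [w + 1 − s, w + 1) otherwise. Since W_s ∪ W_{w+1−s}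
-- = [0, w + 1), the image of a w-union family under π contains at most one set of each
-- such pair. For w = 2ℓ this leaves at most ℓ + 1 hits per permutation. For w = 2ℓ − 1
-- the middle size ℓ is handled by the n cyclic arcs of length ℓ, each other size being
-- counted n times: two disjoint arcs have a union of size 2ℓ > w, so by Katona's cycle
-- lemma at most ℓ arcs are hit, and n ‖𝓕‖ₙ ≤ n ℓ + ℓ.
module Submission where

open import Defs

module BinomialNorm where

  open import Data.Bool using (Bool; true; false; not; _∧_; _∨_; if_then_else_; T)
  import Data.Bool as Bool
  open import Data.Bool.Properties using (T-≡; T-∨; T-∧)
  open import Data.Bool.ListAction using (any)
  open import Data.Nat
  open import Data.Nat.Properties
  open import Data.Nat.Combinatorics using (_C_; nCk≡n!/k![n-k]!; k![n∸k]!∣n!)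
  open import Data.Nat.DivMod using (m/n*n≡m)
  open import Data.Nat.Tactic.RingSolver using (solve-∀)
  open import Algebra.Properties.CommutativeSemigroup +-commutativeSemigroup
    using () renaming (interchange to +-interchange; x∙yz≈y∙xz to x+[y+z]≡y+[x+z]; xy∙z≈xz∙y to x+y+z≡x+z+y)
  open import Algebra.Properties.CommutativeSemigroup *-commutativeSemigroup
    using () renaming (x∙yz≈y∙xz to x*[y*z]≡y*[x*z])
  open import Data.Fin using (Fin; zero; suc)
  open import Data.Vec using (Vec; []; _∷_; lookup; removeAt; insertAt; zipWith)
  open import Data.Vec.Properties using (lookup-zipWith; ∷-injective; insertAt-removeAt; ≡-dec)
  open import Data.Fin.Subset using (Subset; ∣_∣; _∪_)
  open import Data.Fin.Subset.Properties using (∣p∣≤n; ∪-idem)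
  open import Data.List using (List; []; _∷_)
  open import Data.List.Membership.Propositional using (_∈_; find)
  open import Data.List.Relation.Unary.All as All using (All; []; _∷_)
  open import Data.List.Relation.Unary.AllPairs using ([]; _∷_)
  open import Data.List.Relation.Unary.Any using (here; there)
  open import Data.List.Relation.Unary.Any.Properties using (any⁻)
  open import Data.List.Relation.Unary.Unique.Propositional using (Unique)
  open import Data.Empty using (⊥; ⊥-elim)
  open import Data.Product using (∃; _×_; _,_; proj₁; proj₂)
  open import Data.Sum as Sum using (_⊎_; inj₁; inj₂; [_,_]′)
  open import Function using (_∘_; const)
  open import Function.Bundles using (Equivalence)
  open import Relation.Binary.Definitions using (DecidableEquality)
  open import Relation.Binary.PropositionalEquality
  open import Relation.Nullary using (Dec; does; yes; no; ¬_)
  open import Relation.Nullary.Decidable using (dec-true; dec-false)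
  open import Relation.Nullary.Reflects using (ofʸ; ofⁿ)
  import Data.Integer as ℤ
  import Data.Integer.Properties as ℤP
  import Data.Rational as ℚ
  import Data.Rational.Properties as ℚP
  import Data.Rational.Unnormalised as ℚᵘ
  open import Data.Rational.Unnormalised using (mkℚᵘ; *≡*; *≤*)
  import Data.Rational.Unnormalised.Properties as ℚᵘP

  𝟙 : Bool → ℕ
  𝟙 true = 1
  𝟙 false = 0

  𝟙≤1 : ∀ b → 𝟙 b ≤ 1
  𝟙≤1 true = ≤-refl
  𝟙≤1 false = z≤n

  𝟙-∧ : ∀ a b → 𝟙 (a ∧ b) ≡ 𝟙 a * 𝟙 b
  𝟙-∧ true b = sym (+-identityʳ (𝟙 b))
  𝟙-∧ false b = refl

  𝟙-∨ : ∀ a b → (T a → T b → ⊥) → 𝟙 (a ∨ b) ≡ 𝟙 a + 𝟙 b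
  𝟙-∨ true true disjoint = ⊥-elim (disjoint _ _)
  𝟙-∨ true false _ = refl
  𝟙-∨ false b _ = refl

  T-does⇒ : ∀ {p} {P : Set p} (P? : Dec P) → T (does P?) → P
  T-does⇒ (yes p) _ = p

  𝟙-¬T : ∀ {b} → ¬ T b → 𝟙 b ≡ 0
  𝟙-¬T {true} ¬b = ⊥-elim (¬b _)
  𝟙-¬T {false} _ = refl

  𝟙-does-cong : ∀ {p} {P : Set p} (P? : Dec P) {c d} → (P → c ≡ d) → 𝟙 (does P?) * c ≡ 𝟙 (does P?) * d
  𝟙-does-cong (yes p) c≡d = cong (_+ 0) (c≡d p)
  𝟙-does-cong (no _) c≡d = refl

  𝟙-exclusive : ∀ a b → (T a → T b → ⊥) → 𝟙 a + 𝟙 b ≤ 1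
  𝟙-exclusive true true exclusive = ⊥-elim (exclusive _ _)
  𝟙-exclusive true false _ = ≤-refl
  𝟙-exclusive false b _ = 𝟙≤1 b

  m<o∸n⇒m+n<o : ∀ {m n o} → m < o ∸ n → m + n < o
  m<o∸n⇒m+n<o {m} {n} {o} m<o∸n with n ≤? o
  ... | yes n≤o = m≤o∸n⇒m+n≤o (suc m) n≤o m<o∸n
  ... | no n≰o = ⊥-elim (n≮0 (subst (m <_) (m≤n⇒m∸n≡0 (≰⇒≥ n≰o)) m<o∸n))

  ∸-<-offset : ∀ {a j L} → a ≤ j → j < a + L → j ∸ a < L
  ∸-<-offset {a} {j} {L} a≤j j<a+L = subst (j ∸ a <_) (m+n∸m≡n a L) (∸-monoˡ-< j<a+L a≤j)

  ∑< : ℕ → (ℕ → ℕ) → ℕ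
  ∑< zero f = 0
  ∑< (suc n) f = f 0 + ∑< n (f ∘ suc)

  ∑<-cong : ∀ n {f g} → (∀ i → i < n → f i ≡ g i) → ∑< n f ≡ ∑< n g
  ∑<-cong zero f≡g = refl
  ∑<-cong (suc n) f≡g = cong₂ _+_ (f≡g 0 z<s) (∑<-cong n (λ i i<n → f≡g (suc i) (s<s i<n)))

  ∑<-mono-≤ : ∀ n {f g} → (∀ i → i < n → f i ≤ g i) → ∑< n f ≤ ∑< n g
  ∑<-mono-≤ zero f≤g = z≤n
  ∑<-mono-≤ (suc n) f≤g = +-mono-≤ (f≤g 0 z<s) (∑<-mono-≤ n (λ i i<n → f≤g (suc i) (s<s i<n)))

  ∑<-distrib-+ : ∀ n f g → ∑< n (λ i → f i + g i) ≡ ∑< n f + ∑< n g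
  ∑<-distrib-+ zero f g = refl
  ∑<-distrib-+ (suc n) f g =
    trans (cong (f 0 + g 0 +_) (∑<-distrib-+ n (f ∘ suc) (g ∘ suc))) (+-interchange (f 0) (g 0) _ _)

  ∑<-distribˡ-* : ∀ n c f → ∑< n (λ i → c * f i) ≡ c * ∑< n f
  ∑<-distribˡ-* zero c f = sym (*-zeroʳ c)
  ∑<-distribˡ-* (suc n) c f =
    trans (cong (c * f 0 +_) (∑<-distribˡ-* n c (f ∘ suc))) (sym (*-distribˡ-+ c (f 0) _))

  ∑<-const : ∀ n c → ∑< n (const c) ≡ n * c
  ∑<-const zero c = refl
  ∑<-const (suc n) c = cong (c +_) (∑<-const n c)

  ∑<-zero : ∀ n → ∑< n (const 0) ≡ 0
  ∑<-zero n = trans (∑<-const n 0) (*-zeroʳ n)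

  ∑<-snoc : ∀ n f → ∑< (suc n) f ≡ ∑< n f + f n
  ∑<-snoc zero f = +-comm (f 0) 0
  ∑<-snoc (suc n) f = trans (cong (f 0 +_) (∑<-snoc n (f ∘ suc))) (sym (+-assoc (f 0) _ _))

  ∑<-split : ∀ a b f → ∑< (a + b) f ≡ ∑< a f + ∑< b (λ i → f (a + i))
  ∑<-split zero b f = refl
  ∑<-split (suc a) b f = trans (cong (f 0 +_) (∑<-split a b (f ∘ suc))) (sym (+-assoc (f 0) _ _))

  ∑<-reverse : ∀ n f → ∑< n f ≡ ∑< n (λ i → f (n ∸ suc i))
  ∑<-reverse zero f = refl
  ∑<-reverse (suc n) f = begin
      f 0 + ∑< n (f ∘ suc)
    ≡⟨ cong (f 0 +_) (∑<-reverse n (f ∘ suc)) ⟩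
      f 0 + ∑< n (λ i → f (suc (n ∸ suc i)))
    ≡⟨ +-comm (f 0) _ ⟩
      ∑< n (λ i → f (suc (n ∸ suc i))) + f 0
    ≡⟨ cong₂ _+_ (∑<-cong n (λ i i<n → cong f (+-∸-assoc 1 i<n))) (cong f (n∸n≡0 n)) ⟨
      ∑< n (λ i → f (suc n ∸ suc i)) + f (suc n ∸ suc n)
    ≡⟨ ∑<-snoc n (λ i → f (suc n ∸ suc i)) ⟨
      ∑< (suc n) (λ i → f (suc n ∸ suc i))
    ∎
    where open ≡-Reasoning

  ∑<-δ : ∀ n m (g : ℕ → ℕ) → m < n → ∑< n (λ i → 𝟙 (does (m ≟ i)) * g i) ≡ g m
  ∑<-δ (suc n) zero g _ =
    trans (cong₂ _+_ (+-identityʳ (g 0)) (∑<-zero n)) (+-identityʳ (g 0))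
  ∑<-δ (suc n) (suc m) g (s≤s m<n) = ∑<-δ n m (g ∘ suc) m<n

  ∑<-comm : ∀ a b (f : ℕ → ℕ → ℕ) → ∑< a (λ i → ∑< b (f i)) ≡ ∑< b (λ j → ∑< a (λ i → f i j))
  ∑<-comm zero b f = sym (∑<-zero b)
  ∑<-comm (suc a) b f =
    trans (cong (∑< b (f 0) +_) (∑<-comm a b (f ∘ suc))) (sym (∑<-distrib-+ b (f 0) _))

  ∑<-fold : ∀ a f → ∑< (a + a) f ≡ ∑< a (λ i → f i + f (a + a ∸ suc i))
  ∑<-fold a f = begin
      ∑< (a + a) f
    ≡⟨ ∑<-split a a f ⟩
      ∑< a f + ∑< a (λ i → f (a + i))
    ≡⟨ cong (∑< a f +_) (∑<-reverse a (λ i → f (a + i))) ⟩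
      ∑< a f + ∑< a (λ i → f (a + (a ∸ suc i)))
    ≡⟨ ∑<-distrib-+ a f _ ⟨
      ∑< a (λ i → f i + f (a + (a ∸ suc i)))
    ≡⟨ ∑<-cong a (λ i i<a → cong (λ m → f i + f m) (+-∸-assoc a i<a)) ⟨
      ∑< a (λ i → f i + f (a + a ∸ suc i))
    ∎
    where open ≡-Reasoning

  ∑<-fold-odd : ∀ a f → ∑< (suc (a + a)) f ≡ f a + ∑< a (λ i → f i + f (a + a ∸ i))
  ∑<-fold-odd a f = begin
      ∑< (suc (a + a)) f
    ≡⟨ cong (λ m → ∑< m f) (+-suc a a) ⟨
      ∑< (a + suc a) f
    ≡⟨ ∑<-split a (suc a) f ⟩
      ∑< a f + (f (a + 0) + ∑< a (λ i → f (a + suc i)))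
    ≡⟨ cong (λ m → ∑< a f + (f m + ∑< a (λ i → f (a + suc i)))) (+-identityʳ a) ⟩
      ∑< a f + (f a + ∑< a (λ i → f (a + suc i)))
    ≡⟨ x+[y+z]≡y+[x+z] (∑< a f) (f a) _ ⟩
      f a + (∑< a f + ∑< a (λ i → f (a + suc i)))
    ≡⟨ cong (λ m → f a + (∑< a f + m)) (∑<-reverse a (λ i → f (a + suc i))) ⟩
      f a + (∑< a f + ∑< a (λ i → f (a + suc (a ∸ suc i))))
    ≡⟨ cong (f a +_) (∑<-distrib-+ a f _) ⟨
      f a + ∑< a (λ i → f i + f (a + suc (a ∸ suc i)))
    ≡⟨ cong (f a +_) (∑<-cong a (λ i i<a → cong (λ m → f i + f m) (reflect i<a))) ⟩
      f a + ∑< a (λ i → f i + f (a + a ∸ i))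
    ∎
    where
    open ≡-Reasoning
    reflect : ∀ {i} → i < a → a + suc (a ∸ suc i) ≡ a + a ∸ i
    reflect {i} i<a = begin
        a + suc (a ∸ suc i)
      ≡⟨ cong (a +_) (+-∸-assoc 1 i<a) ⟨
        a + (a ∸ i)
      ≡⟨ +-∸-assoc a (<⇒≤ i<a) ⟨
        a + a ∸ i
      ∎

  ∑<-none : ∀ n (P : ℕ → Bool) → (∀ i → i < n → ¬ T (P i)) → ∑< n (𝟙 ∘ P) ≡ 0
  ∑<-none n P none = trans (∑<-cong n (λ i i<n → 𝟙-¬T (none i i<n))) (∑<-zero n)

  ∑<-≤1 : ∀ n (P : ℕ → Bool) → (∀ i j → i < n → j < n → T (P i) → T (P j) → i ≡ j) → ∑< n (𝟙 ∘ P) ≤ 1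
  ∑<-≤1 zero P _ = z≤n
  ∑<-≤1 (suc n) P unique with P 0 in P0
  ... | false = ∑<-≤1 n (P ∘ suc) λ i j i<n j<n Pi Pj →
    suc-injective (unique (suc i) (suc j) (s<s i<n) (s<s j<n) Pi Pj)
  ... | true = ≤-reflexive (cong suc (∑<-none n (P ∘ suc) λ i i<n P[1+i] →
    1+n≢0 (unique (suc i) 0 (s<s i<n) z<s P[1+i] (Equivalence.from T-≡ P0))))

  ∑<-≤-injection : ∀ n L (P : ℕ → Bool) (h : ℕ → ℕ) → (∀ i → i < n → T (P i) → h i < L) →
    (∀ i j → i < n → j < n → T (P i) → T (P j) → h i ≡ h j → i ≡ j) → ∑< n (𝟙 ∘ P) ≤ L
  ∑<-≤-injection n L P h h<L h-injective = begin
      ∑< n (𝟙 ∘ P)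
    ≡⟨ ∑<-cong n fibres ⟨
      ∑< n (λ i → ∑< L (λ y → 𝟙 (P i ∧ does (h i ≟ y))))
    ≡⟨ ∑<-comm n L _ ⟩
      ∑< L (λ y → ∑< n (λ i → 𝟙 (P i ∧ does (h i ≟ y))))
    ≤⟨ ∑<-mono-≤ L (λ y _ → ∑<-≤1 n _ (λ i j i<n j<n i↦y j↦y → h-injective i j i<n j<n
         (proj₁ (split i↦y)) (proj₁ (split j↦y))
         (trans (T-does⇒ (h i ≟ y) (proj₂ (split i↦y))) (sym (T-does⇒ (h j ≟ y) (proj₂ (split j↦y))))))) ⟩
      ∑< L (const 1)
    ≡⟨ trans (∑<-const L 1) (*-identityʳ L) ⟩
      L
    ∎
    where
    open ≤-Reasoning
    split : ∀ {a b} → T (a ∧ b) → T a × T b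
    split = Equivalence.to T-∧
    fibres : ∀ i → i < n → ∑< L (λ y → 𝟙 (P i ∧ does (h i ≟ y))) ≡ 𝟙 (P i)
    fibres i i<n with P i in Pi
    ... | false = ∑<-zero L
    ... | true = trans (∑<-cong L (λ y _ → sym (*-identityʳ _)))
                       (∑<-δ L (h i) (const 1) (h<L i i<n (Equivalence.from T-≡ Pi)))

  least : ∀ n (P : ℕ → Bool) →
    (∀ i → i < n → ¬ T (P i)) ⊎ ∃ λ m → m < n × T (P m) × (∀ i → i < m → ¬ T (P i))
  least zero P = inj₁ (λ _ ())
  least (suc n) P with least n P
  ... | inj₂ (m , m<n , Pm , below) = inj₂ (m , m<n⇒m<1+n m<n , Pm , below)
  ... | inj₁ none with P n in Pn
  ...   | true = inj₂ (n , ≤-refl , Equivalence.from T-≡ Pn , none)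
  ...   | false = inj₁ λ i i<1+n → [ none i , (λ { refl → subst T Pn }) ]′ (m<1+n⇒m<n∨m≡n i<1+n)

  ∑ᶠ : ∀ {n} → (Fin n → ℕ) → ℕ
  ∑ᶠ {zero} f = 0
  ∑ᶠ {suc n} f = f zero + ∑ᶠ (f ∘ suc)

  ∑ᶠ-cong : ∀ {n} {f g : Fin n → ℕ} → (∀ i → f i ≡ g i) → ∑ᶠ f ≡ ∑ᶠ g
  ∑ᶠ-cong {zero} f≡g = refl
  ∑ᶠ-cong {suc n} f≡g = cong₂ _+_ (f≡g zero) (∑ᶠ-cong (f≡g ∘ suc))

  ∑ᶠ-mono-≤ : ∀ {n} {f g : Fin n → ℕ} → (∀ i → f i ≤ g i) → ∑ᶠ f ≤ ∑ᶠ g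
  ∑ᶠ-mono-≤ {zero} f≤g = z≤n
  ∑ᶠ-mono-≤ {suc n} f≤g = +-mono-≤ (f≤g zero) (∑ᶠ-mono-≤ (f≤g ∘ suc))

  ∑ᶠ-distrib-+ : ∀ {n} (f g : Fin n → ℕ) → ∑ᶠ (λ i → f i + g i) ≡ ∑ᶠ f + ∑ᶠ g
  ∑ᶠ-distrib-+ {zero} f g = refl
  ∑ᶠ-distrib-+ {suc n} f g =
    trans (cong (f zero + g zero +_) (∑ᶠ-distrib-+ (f ∘ suc) (g ∘ suc))) (+-interchange (f zero) (g zero) _ _)

  ∑ᶠ-distribˡ-* : ∀ {n} c (f : Fin n → ℕ) → ∑ᶠ (λ i → c * f i) ≡ c * ∑ᶠ f
  ∑ᶠ-distribˡ-* {zero} c f = sym (*-zeroʳ c)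
  ∑ᶠ-distribˡ-* {suc n} c f =
    trans (cong (c * f zero +_) (∑ᶠ-distribˡ-* c (f ∘ suc))) (sym (*-distribˡ-+ c (f zero) _))

  ∑ᶠ-const : ∀ n c → ∑ᶠ {n} (const c) ≡ n * c
  ∑ᶠ-const zero c = refl
  ∑ᶠ-const (suc n) c = cong (c +_) (∑ᶠ-const n c)

  ∣x∷p∣ : ∀ {n} x (p : Subset n) → ∣ x ∷ p ∣ ≡ 𝟙 x + ∣ p ∣
  ∣x∷p∣ true p = refl
  ∣x∷p∣ false p = refl

  ∑ᶠ-lookup : ∀ {n} (p : Subset n) → ∑ᶠ (λ i → 𝟙 (lookup p i)) ≡ ∣ p ∣
  ∑ᶠ-lookup [] = refl
  ∑ᶠ-lookup (x ∷ p) = trans (cong (𝟙 x +_) (∑ᶠ-lookup p)) (sym (∣x∷p∣ x p))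

  ∑ᶠ-lookup-not : ∀ {n} (p : Subset n) → ∑ᶠ (λ i → 𝟙 (not (lookup p i))) + ∣ p ∣ ≡ n
  ∑ᶠ-lookup-not [] = refl
  ∑ᶠ-lookup-not (true ∷ p) = trans (+-suc _ ∣ p ∣) (cong suc (∑ᶠ-lookup-not p))
  ∑ᶠ-lookup-not (false ∷ p) = cong suc (∑ᶠ-lookup-not p)

  ∣removeAt∣ : ∀ {n} (p : Subset (suc n)) i → 𝟙 (lookup p i) + ∣ removeAt p i ∣ ≡ ∣ p ∣
  ∣removeAt∣ (x ∷ p) zero = sym (∣x∷p∣ x p)
  ∣removeAt∣ (x ∷ p@(_ ∷ _)) (suc i) = begin
      𝟙 (lookup p i) + ∣ x ∷ removeAt p i ∣
    ≡⟨ cong (𝟙 (lookup p i) +_) (∣x∷p∣ x (removeAt p i)) ⟩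
      𝟙 (lookup p i) + (𝟙 x + ∣ removeAt p i ∣)
    ≡⟨ x+[y+z]≡y+[x+z] (𝟙 (lookup p i)) (𝟙 x) _ ⟩
      𝟙 x + (𝟙 (lookup p i) + ∣ removeAt p i ∣)
    ≡⟨ cong (𝟙 x +_) (∣removeAt∣ p i) ⟩
      𝟙 x + ∣ p ∣
    ≡⟨ ∣x∷p∣ x p ⟨
      ∣ x ∷ p ∣
    ∎
    where open ≡-Reasoning

  -- Permutations of n points as Lehmer codes: the point sent to position 0,
  -- followed by a permutation of the remaining n ∸ 1 points.
  data Perm : ℕ → Set where
    [] : Perm 0
    _∷_ : ∀ {n} → Fin (suc n) → Perm n → Perm (suc n)

  permute : ∀ {a} {A : Set a} {n} → Perm n → Vec A n → Vec A n
  permute [] [] = []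
  permute (i ∷ σ) xs = lookup xs i ∷ permute σ (removeAt xs i)

  ∣permute∣ : ∀ {n} (π : Perm n) (p : Subset n) → ∣ permute π p ∣ ≡ ∣ p ∣
  ∣permute∣ [] [] = refl
  ∣permute∣ (i ∷ σ) p = begin
      ∣ lookup p i ∷ permute σ (removeAt p i) ∣
    ≡⟨ ∣x∷p∣ (lookup p i) (permute σ (removeAt p i)) ⟩
      𝟙 (lookup p i) + ∣ permute σ (removeAt p i) ∣
    ≡⟨ cong (𝟙 (lookup p i) +_) (∣permute∣ σ (removeAt p i)) ⟩
      𝟙 (lookup p i) + ∣ removeAt p i ∣
    ≡⟨ ∣removeAt∣ p i ⟩
      ∣ p ∣
    ∎
    where open ≡-Reasoning

  permute-injective : ∀ {a} {A : Set a} {n} (π : Perm n) {xs ys : Vec A n} →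
                      permute π xs ≡ permute π ys → xs ≡ ys
  permute-injective [] {[]} {[]} _ = refl
  permute-injective (i ∷ σ) {xs} {ys} eq = begin
      xs
    ≡⟨ insertAt-removeAt xs i ⟨
      insertAt (removeAt xs i) i (lookup xs i)
    ≡⟨ cong₂ (λ zs z → insertAt zs i z) (permute-injective σ tails) heads ⟩
      insertAt (removeAt ys i) i (lookup ys i)
    ≡⟨ insertAt-removeAt ys i ⟩
      ys
    ∎
    where
    open ≡-Reasoning
    heads : lookup xs i ≡ lookup ys i
    heads = proj₁ (∷-injective eq)
    tails : permute σ (removeAt xs i) ≡ permute σ (removeAt ys i)
    tails = proj₂ (∷-injective eq)

  removeAt-zipWith : ∀ {a b c} {A : Set a} {B : Set b} {C : Set c} {n} (f : A → B → C)
                     (xs : Vec A (suc n)) (ys : Vec B (suc n)) i →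
                     removeAt (zipWith f xs ys) i ≡ zipWith f (removeAt xs i) (removeAt ys i)
  removeAt-zipWith f (x ∷ xs) (y ∷ ys) zero = refl
  removeAt-zipWith f (x ∷ xs@(_ ∷ _)) (y ∷ ys@(_ ∷ _)) (suc i) = cong (f x y ∷_) (removeAt-zipWith f xs ys i)

  permute-zipWith : ∀ {a b c} {A : Set a} {B : Set b} {C : Set c} {n} (f : A → B → C)
                    (π : Perm n) xs ys → permute π (zipWith f xs ys) ≡ zipWith f (permute π xs) (permute π ys)
  permute-zipWith f [] [] [] = refl
  permute-zipWith f (i ∷ σ) xs ys = cong₂ _∷_ (lookup-zipWith f i xs ys)
    (trans (cong (permute σ) (removeAt-zipWith f xs ys i)) (permute-zipWith f σ _ _))

  ∑ᵖ : ∀ n → (Perm n → ℕ) → ℕ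
  ∑ᵖ zero f = f []
  ∑ᵖ (suc n) f = ∑ᶠ (λ i → ∑ᵖ n (λ σ → f (i ∷ σ)))

  ∑ᵖ-mono-≤ : ∀ n {f g : Perm n → ℕ} → (∀ π → f π ≤ g π) → ∑ᵖ n f ≤ ∑ᵖ n g
  ∑ᵖ-mono-≤ zero f≤g = f≤g []
  ∑ᵖ-mono-≤ (suc n) f≤g = ∑ᶠ-mono-≤ (λ i → ∑ᵖ-mono-≤ n (λ σ → f≤g (i ∷ σ)))

  ∑ᵖ-cong : ∀ n {f g : Perm n → ℕ} → (∀ π → f π ≡ g π) → ∑ᵖ n f ≡ ∑ᵖ n g
  ∑ᵖ-cong zero f≡g = f≡g []
  ∑ᵖ-cong (suc n) f≡g = ∑ᶠ-cong (λ i → ∑ᵖ-cong n (λ σ → f≡g (i ∷ σ)))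

  ∑ᵖ-distrib-+ : ∀ n (f g : Perm n → ℕ) → ∑ᵖ n (λ π → f π + g π) ≡ ∑ᵖ n f + ∑ᵖ n g
  ∑ᵖ-distrib-+ zero f g = refl
  ∑ᵖ-distrib-+ (suc n) f g = trans (∑ᶠ-cong (λ i → ∑ᵖ-distrib-+ n (λ σ → f (i ∷ σ)) (λ σ → g (i ∷ σ))))
    (∑ᶠ-distrib-+ (λ i → ∑ᵖ n (λ σ → f (i ∷ σ))) (λ i → ∑ᵖ n (λ σ → g (i ∷ σ))))

  ∑ᵖ-distribˡ-* : ∀ n c (f : Perm n → ℕ) → ∑ᵖ n (λ π → c * f π) ≡ c * ∑ᵖ n f
  ∑ᵖ-distribˡ-* zero c f = refl
  ∑ᵖ-distribˡ-* (suc n) c f = trans (∑ᶠ-cong (λ i → ∑ᵖ-distribˡ-* n c (λ σ → f (i ∷ σ))))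
    (∑ᶠ-distribˡ-* c (λ i → ∑ᵖ n (λ σ → f (i ∷ σ))))

  ∑ᵖ-const : ∀ n c → ∑ᵖ n (const c) ≡ n ! * c
  ∑ᵖ-const zero c = sym (+-identityʳ c)
  ∑ᵖ-const (suc n) c = begin
      ∑ᶠ {suc n} (λ _ → ∑ᵖ n (const c))
    ≡⟨ ∑ᶠ-cong {suc n} (λ _ → ∑ᵖ-const n c) ⟩
      ∑ᶠ {suc n} (const (n ! * c))
    ≡⟨ ∑ᶠ-const (suc n) (n ! * c) ⟩
      suc n * (n ! * c)
    ≡⟨ *-assoc (suc n) (n !) c ⟨
      suc n ! * c
    ∎
    where open ≡-Reasoning

  infix 4 _≟ˢ_
  _≟ˢ_ : ∀ {n} → DecidableEquality (Subset n)
  _≟ˢ_ = ≡-dec Bool._≟_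

  private
    firstPoint-inside : ∀ x d s k K → 𝟙 x + d ≡ s →
      𝟙 (does (x Bool.≟ true)) * (𝟙 (does (d ≟ k)) * K) ≡ 𝟙 (does (s ≟ suc k)) * K * 𝟙 x
    firstPoint-inside true d .(suc d) k K refl = trans (+-identityʳ (𝟙 (does (d ≟ k)) * K)) (sym (*-identityʳ _))
    firstPoint-inside false d s k K _ = sym (*-zeroʳ (𝟙 (does (s ≟ suc k)) * K))

    firstPoint-outside : ∀ x d s k K → 𝟙 x + d ≡ s →
      𝟙 (does (x Bool.≟ false)) * (𝟙 (does (d ≟ k)) * K) ≡ 𝟙 (does (s ≟ k)) * K * 𝟙 (not x)
    firstPoint-outside true d s k K _ = sym (*-zeroʳ (𝟙 (does (s ≟ k)) * K))
    firstPoint-outside false d .d k K refl = trans (+-identityʳ (𝟙 (does (d ≟ k)) * K)) (sym (*-identityʳ _))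

  ∑ᶠ-removeAt-inside : ∀ {n} (p : Subset (suc n)) k K →
    ∑ᶠ (λ i → 𝟙 (does (lookup p i Bool.≟ true)) * (𝟙 (does (∣ removeAt p i ∣ ≟ k)) * K))
      ≡ 𝟙 (does (∣ p ∣ ≟ suc k)) * (K * ∣ p ∣)
  ∑ᶠ-removeAt-inside p k K = begin
      ∑ᶠ (λ i → 𝟙 (does (lookup p i Bool.≟ true)) * (𝟙 (does (∣ removeAt p i ∣ ≟ k)) * K))
    ≡⟨ ∑ᶠ-cong (λ i → firstPoint-inside (lookup p i) _ _ k K (∣removeAt∣ p i)) ⟩
      ∑ᶠ (λ i → 𝟙 (does (∣ p ∣ ≟ suc k)) * K * 𝟙 (lookup p i))
    ≡⟨ ∑ᶠ-distribˡ-* (𝟙 (does (∣ p ∣ ≟ suc k)) * K) (λ i → 𝟙 (lookup p i)) ⟩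
      𝟙 (does (∣ p ∣ ≟ suc k)) * K * ∑ᶠ (λ i → 𝟙 (lookup p i))
    ≡⟨ cong (𝟙 (does (∣ p ∣ ≟ suc k)) * K *_) (∑ᶠ-lookup p) ⟩
      𝟙 (does (∣ p ∣ ≟ suc k)) * K * ∣ p ∣
    ≡⟨ *-assoc (𝟙 (does (∣ p ∣ ≟ suc k))) K ∣ p ∣ ⟩
      𝟙 (does (∣ p ∣ ≟ suc k)) * (K * ∣ p ∣)
    ∎
    where open ≡-Reasoning

  ∑ᶠ-removeAt-outside : ∀ {n} (p : Subset (suc n)) k K →
    ∑ᶠ (λ i → 𝟙 (does (lookup p i Bool.≟ false)) * (𝟙 (does (∣ removeAt p i ∣ ≟ k)) * K))
      ≡ 𝟙 (does (∣ p ∣ ≟ k)) * (K * (suc n ∸ ∣ p ∣))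
  ∑ᶠ-removeAt-outside {n} p k K = begin
      ∑ᶠ (λ i → 𝟙 (does (lookup p i Bool.≟ false)) * (𝟙 (does (∣ removeAt p i ∣ ≟ k)) * K))
    ≡⟨ ∑ᶠ-cong (λ i → firstPoint-outside (lookup p i) _ _ k K (∣removeAt∣ p i)) ⟩
      ∑ᶠ (λ i → 𝟙 (does (∣ p ∣ ≟ k)) * K * 𝟙 (not (lookup p i)))
    ≡⟨ ∑ᶠ-distribˡ-* (𝟙 (does (∣ p ∣ ≟ k)) * K) (λ i → 𝟙 (not (lookup p i))) ⟩
      𝟙 (does (∣ p ∣ ≟ k)) * K * ∑ᶠ (λ i → 𝟙 (not (lookup p i)))
    ≡⟨ cong (𝟙 (does (∣ p ∣ ≟ k)) * K *_) outside ⟩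
      𝟙 (does (∣ p ∣ ≟ k)) * K * (suc n ∸ ∣ p ∣)
    ≡⟨ *-assoc (𝟙 (does (∣ p ∣ ≟ k))) K _ ⟩
      𝟙 (does (∣ p ∣ ≟ k)) * (K * (suc n ∸ ∣ p ∣))
    ∎
    where
    open ≡-Reasoning
    outside : ∑ᶠ (λ i → 𝟙 (not (lookup p i))) ≡ suc n ∸ ∣ p ∣
    outside = trans (sym (m+n∸n≡m _ ∣ p ∣)) (cong (_∸ ∣ p ∣) (∑ᶠ-lookup-not p))

  ∑ᵖ-permute≡ : ∀ n (p q : Subset n) →
    ∑ᵖ n (λ π → 𝟙 (does (permute π p ≟ˢ q))) ≡ 𝟙 (does (∣ p ∣ ≟ ∣ q ∣)) * (∣ q ∣ ! * (n ∸ ∣ q ∣) !)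
  ∑ᵖ-permute≡ zero [] [] = refl
  ∑ᵖ-permute≡ (suc n) p (b ∷ q) = trans byFirstPoint (byHead b)
    where
    k : ℕ
    k = ∣ q ∣
    K : ℕ
    K = k ! * (n ∸ k) !
    term : Bool → Fin (suc n) → ℕ
    term b i = 𝟙 (does (lookup p i Bool.≟ b)) * (𝟙 (does (∣ removeAt p i ∣ ≟ k)) * K)

    byFirstPoint : ∑ᵖ (suc n) (λ π → 𝟙 (does (permute π p ≟ˢ b ∷ q))) ≡ ∑ᶠ (term b)
    byFirstPoint = ∑ᶠ-cong λ i → trans
      (∑ᵖ-cong n (λ σ → 𝟙-∧ (does (lookup p i Bool.≟ b)) (does (permute σ (removeAt p i) ≟ˢ q))))
      (trans (∑ᵖ-distribˡ-* n (𝟙 (does (lookup p i Bool.≟ b))) (λ σ → 𝟙 (does (permute σ (removeAt p i) ≟ˢ q))))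
        (cong (𝟙 (does (lookup p i Bool.≟ b)) *_) (∑ᵖ-permute≡ n (removeAt p i) q)))

    byHead : ∀ b → ∑ᶠ (term b) ≡ 𝟙 (does (∣ p ∣ ≟ ∣ b ∷ q ∣)) * (∣ b ∷ q ∣ ! * (suc n ∸ ∣ b ∷ q ∣) !)
    byHead true = trans (∑ᶠ-removeAt-inside p k K)
      (𝟙-does-cong (∣ p ∣ ≟ suc k) (λ ∣p∣≡1+k → trans (cong (K *_) ∣p∣≡1+k) (rearrange k (k !) ((n ∸ k) !))))
      where
      rearrange : ∀ k a b → a * b * suc k ≡ suc k * a * b
      rearrange = solve-∀
    byHead false = trans (∑ᶠ-removeAt-outside p k K)
      (𝟙-does-cong (∣ p ∣ ≟ k) (λ ∣p∣≡k → begin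
          K * (suc n ∸ ∣ p ∣)      ≡⟨ cong (λ m → K * (suc n ∸ m)) ∣p∣≡k ⟩
          K * (suc n ∸ k)          ≡⟨ cong (K *_) (+-∸-assoc 1 (∣p∣≤n q)) ⟩
          K * suc (n ∸ k)          ≡⟨ rearrange (n ∸ k) (k !) ((n ∸ k) !) ⟩
          k ! * suc (n ∸ k) !      ≡⟨ cong (λ m → k ! * m !) (+-∸-assoc 1 (∣p∣≤n q)) ⟨
          k ! * (suc n ∸ k) !      ∎))
      where
      open ≡-Reasoning
      rearrange : ∀ m a b → a * b * suc m ≡ a * (suc m * b)
      rearrange = solve-∀

  -- Double counting

  module _ {a} {A : Set a} where

    ∑ˡ : List A → (A → ℕ) → ℕ
    ∑ˡ [] f = 0
    ∑ˡ (x ∷ xs) f = f x + ∑ˡ xs f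

    ∑ˡ-cong : ∀ xs {f g : A → ℕ} → (∀ x → x ∈ xs → f x ≡ g x) → ∑ˡ xs f ≡ ∑ˡ xs g
    ∑ˡ-cong [] f≡g = refl
    ∑ˡ-cong (x ∷ xs) f≡g = cong₂ _+_ (f≡g x (here refl)) (∑ˡ-cong xs (λ y y∈xs → f≡g y (there y∈xs)))

    ∑ˡ-distribˡ-* : ∀ xs c (f : A → ℕ) → ∑ˡ xs (λ x → c * f x) ≡ c * ∑ˡ xs f
    ∑ˡ-distribˡ-* [] c f = sym (*-zeroʳ c)
    ∑ˡ-distribˡ-* (x ∷ xs) c f =
      trans (cong (c * f x +_) (∑ˡ-distribˡ-* xs c f)) (sym (*-distribˡ-+ c (f x) _))

    ∑ˡ-∑< : ∀ xs m (f : A → ℕ → ℕ) → ∑ˡ xs (λ x → ∑< m (f x)) ≡ ∑< m (λ i → ∑ˡ xs (λ x → f x i))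
    ∑ˡ-∑< [] m f = sym (∑<-zero m)
    ∑ˡ-∑< (x ∷ xs) m f =
      trans (cong (∑< m (f x) +_) (∑ˡ-∑< xs m f)) (sym (∑<-distrib-+ m (f x) _))

    ∑ˡ-∑ᵖ : ∀ xs n (f : A → Perm n → ℕ) → ∑ˡ xs (λ x → ∑ᵖ n (f x)) ≡ ∑ᵖ n (λ π → ∑ˡ xs (λ x → f x π))
    ∑ˡ-∑ᵖ [] n f = sym (trans (∑ᵖ-const n 0) (*-zeroʳ (n !)))
    ∑ˡ-∑ᵖ (x ∷ xs) n f =
      trans (cong (∑ᵖ n (f x) +_) (∑ˡ-∑ᵖ xs n f)) (sym (∑ᵖ-distrib-+ n (f x) _))

    ∑ˡ-none : ∀ (P : A → Bool) xs → All (λ x → ¬ T (P x)) xs → ∑ˡ xs (𝟙 ∘ P) ≡ 0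
    ∑ˡ-none P [] [] = refl
    ∑ˡ-none P (x ∷ xs) (¬Px ∷ ¬Pxs) = cong₂ _+_ (𝟙-¬T ¬Px) (∑ˡ-none P xs ¬Pxs)

    ∑ˡ-≤-any : ∀ (P : A → Bool) xs → Unique xs → (∀ x y → T (P x) → T (P y) → x ≡ y) →
               ∑ˡ xs (𝟙 ∘ P) ≤ 𝟙 (any P xs)
    ∑ˡ-≤-any P [] [] _ = z≤n
    ∑ˡ-≤-any P (x ∷ xs) (x∉xs ∷ unique) P-injective with P x in Px
    ... | false = ∑ˡ-≤-any P xs unique P-injective
    ... | true = ≤-reflexive (cong suc (∑ˡ-none P xs (All.map (λ x≢y Py → x≢y (P-injective x _ T-Px Py)) x∉xs)))
      where
      T-Px : T (P x)
      T-Px = Equivalence.from T-≡ Px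

  ∑<-∑ᵖ : ∀ m n (f : ℕ → Perm n → ℕ) → ∑< m (λ i → ∑ᵖ n (f i)) ≡ ∑ᵖ n (λ π → ∑< m (λ i → f i π))
  ∑<-∑ᵖ zero n f = sym (trans (∑ᵖ-const n 0) (*-zeroʳ (n !)))
  ∑<-∑ᵖ (suc m) n f =
    trans (cong (∑ᵖ n (f 0) +_) (∑<-∑ᵖ m n (f ∘ suc))) (sym (∑ᵖ-distrib-+ n (f 0) _))

  weightSum : ∀ {n} → List (Subset n) → ℕ
  weightSum {n} 𝓕 = ∑ˡ 𝓕 (λ F → ∣ F ∣ ! * (n ∸ ∣ F ∣) !)

  inImage : ∀ {n} → List (Subset n) → Perm n → Subset n → Bool
  inImage 𝓕 π W = any (λ F → does (permute π F ≟ˢ W)) 𝓕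

  -- Count pairs (π, F) with π carrying F onto one of c reference sets of each size s < t:
  -- a fixed F is carried onto a fixed set of its size by |F|! (n ∸ |F|)! permutations,
  -- while a fixed π carries at most one F onto a given set.
  weightSum-≤ : ∀ n t c M (𝓕 : List (Subset n)) → Unique 𝓕 → (∀ F → F ∈ 𝓕 → ∣ F ∣ < t) →
    (ref : ℕ → ℕ → Subset n) → (∀ s j → s < t → j < c → ∣ ref s j ∣ ≡ s) →
    (∀ π → ∑< t (λ s → ∑< c (λ j → 𝟙 (inImage 𝓕 π (ref s j)))) ≤ M) →
    c * weightSum 𝓕 ≤ n ! * M
  weightSum-≤ n t c M 𝓕 unique small ref ∣ref∣ perPermutation = begin
      c * weightSum 𝓕
    ≡⟨ ∑ˡ-distribˡ-* 𝓕 c weight ⟨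
      ∑ˡ 𝓕 (λ F → c * weight F)
    ≡⟨ ∑ˡ-cong 𝓕 (λ F F∈𝓕 → sym (carriedOnto F (small F F∈𝓕))) ⟩
      ∑ˡ 𝓕 (λ F → ∑< t (λ s → ∑< c (λ j → ∑ᵖ n (λ π → hit π F s j))))
    ≡⟨ ∑ˡ-∑< 𝓕 t _ ⟩
      ∑< t (λ s → ∑ˡ 𝓕 (λ F → ∑< c (λ j → ∑ᵖ n (λ π → hit π F s j))))
    ≡⟨ ∑<-cong t (λ s _ → trans (∑ˡ-∑< 𝓕 c _) (∑<-cong c (λ j _ → ∑ˡ-∑ᵖ 𝓕 n (λ F π → hit π F s j)))) ⟩
      ∑< t (λ s → ∑< c (λ j → ∑ᵖ n (λ π → ∑ˡ 𝓕 (λ F → hit π F s j))))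
    ≤⟨ ∑<-mono-≤ t (λ s _ → ∑<-mono-≤ c (λ j _ → ∑ᵖ-mono-≤ n (λ π → atMostOne π (ref s j)))) ⟩
      ∑< t (λ s → ∑< c (λ j → ∑ᵖ n (λ π → 𝟙 (inImage 𝓕 π (ref s j)))))
    ≡⟨ trans (∑<-cong t (λ s _ → ∑<-∑ᵖ c n _)) (∑<-∑ᵖ t n _) ⟩
      ∑ᵖ n (λ π → ∑< t (λ s → ∑< c (λ j → 𝟙 (inImage 𝓕 π (ref s j)))))
    ≤⟨ ∑ᵖ-mono-≤ n perPermutation ⟩
      ∑ᵖ n (const M)
    ≡⟨ ∑ᵖ-const n M ⟩
      n ! * M
    ∎
    where
    open ≤-Reasoning
    weight : Subset n → ℕ
    weight F = ∣ F ∣ ! * (n ∸ ∣ F ∣) !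
    hit : Perm n → Subset n → ℕ → ℕ → ℕ
    hit π F s j = 𝟙 (does (permute π F ≟ˢ ref s j))

    atMostOne : ∀ π W → ∑ˡ 𝓕 (λ F → 𝟙 (does (permute π F ≟ˢ W))) ≤ 𝟙 (inImage 𝓕 π W)
    atMostOne π W = ∑ˡ-≤-any (λ F → does (permute π F ≟ˢ W)) 𝓕 unique
      (λ F G πF≡W πG≡W → permute-injective π
        (trans (T-does⇒ (permute π F ≟ˢ W) πF≡W) (sym (T-does⇒ (permute π G ≟ˢ W) πG≡W))))

    carriedOnto : ∀ F → ∣ F ∣ < t → ∑< t (λ s → ∑< c (λ j → ∑ᵖ n (λ π → hit π F s j))) ≡ c * weight F
    carriedOnto F ∣F∣<t = begin-equality
        ∑< t (λ s → ∑< c (λ j → ∑ᵖ n (λ π → hit π F s j)))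
      ≡⟨ ∑<-cong t (λ s s<t → ∑<-cong c (λ j j<c → trans (∑ᵖ-permute≡ n F (ref s j))
                     (cong (λ m → 𝟙 (does (∣ F ∣ ≟ m)) * (m ! * (n ∸ m) !)) (∣ref∣ s j s<t j<c)))) ⟩
        ∑< t (λ s → ∑< c (const (𝟙 (does (∣ F ∣ ≟ s)) * (s ! * (n ∸ s) !))))
      ≡⟨ ∑<-cong t (λ s _ → trans (∑<-const c _) (x*[y*z]≡y*[x*z] c (𝟙 (does (∣ F ∣ ≟ s))) _)) ⟩
        ∑< t (λ s → 𝟙 (does (∣ F ∣ ≟ s)) * (c * (s ! * (n ∸ s) !)))
      ≡⟨ ∑<-δ t ∣ F ∣ (λ s → c * (s ! * (n ∸ s) !)) ∣F∣<t ⟩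
        c * weight F
      ∎

  -- Windows

  toSubset : ∀ n → (ℕ → Bool) → Subset n
  toSubset zero P = []
  toSubset (suc n) P = P 0 ∷ toSubset n (P ∘ suc)

  ∣toSubset∣ : ∀ n P → ∣ toSubset n P ∣ ≡ ∑< n (𝟙 ∘ P)
  ∣toSubset∣ zero P = refl
  ∣toSubset∣ (suc n) P = trans (∣x∷p∣ (P 0) (toSubset n (P ∘ suc))) (cong (𝟙 (P 0) +_) (∣toSubset∣ n (P ∘ suc)))

  toSubset-∪ : ∀ n P Q → toSubset n P ∪ toSubset n Q ≡ toSubset n (λ x → P x ∨ Q x)
  toSubset-∪ zero P Q = refl
  toSubset-∪ (suc n) P Q = cong ((P 0 ∨ Q 0) ∷_) (toSubset-∪ n (P ∘ suc) (Q ∘ suc))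

  toSubset-cong : ∀ n {P Q} → (∀ x → x < n → P x ≡ Q x) → toSubset n P ≡ toSubset n Q
  toSubset-cong zero P≡Q = refl
  toSubset-cong (suc n) P≡Q = cong₂ _∷_ (P≡Q 0 z<s) (toSubset-cong n (λ x x<n → P≡Q (suc x) (s<s x<n)))

  ∑<-<ᵇ : ∀ n b → ∑< n (λ x → 𝟙 (x <ᵇ b)) ≡ n ⊓ b
  ∑<-<ᵇ zero b = refl
  ∑<-<ᵇ (suc n) zero = ∑<-zero n
  ∑<-<ᵇ (suc n) (suc b) = cong suc (∑<-<ᵇ n b)

  inInterval : ℕ → ℕ → ℕ → Bool
  inInterval a b x = not (x <ᵇ a) ∧ (x <ᵇ b)

  𝟙-inInterval : ∀ {a b} x → a ≤ b → 𝟙 (inInterval a b x) + 𝟙 (x <ᵇ a) ≡ 𝟙 (x <ᵇ b)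
  𝟙-inInterval {a} {b} x a≤b with x <ᵇ a | <ᵇ-reflects-< x a | x <ᵇ b | <ᵇ-reflects-< x b
  ... | true | ofʸ x<a | false | ofⁿ x≮b = ⊥-elim (x≮b (<-≤-trans x<a a≤b))
  ... | true | _ | true | _ = refl
  ... | false | _ | true | _ = refl
  ... | false | _ | false | _ = refl

  inInterval⇒ : ∀ {a b} x → T (inInterval a b x) → a ≤ x × x < b
  inInterval⇒ {a} {b} x with x <ᵇ a | <ᵇ-reflects-< x a | x <ᵇ b | <ᵇ-reflects-< x b
  ... | true | _ | _ | _ = λ ()
  ... | false | _ | false | _ = λ ()
  ... | false | ofⁿ x≮a | true | ofʸ x<b = λ _ → ≮⇒≥ x≮a , x<b

  ∑<-inInterval : ∀ n {a b} → a ≤ b → ∑< n (𝟙 ∘ inInterval a b) ≡ n ⊓ b ∸ n ⊓ a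
  ∑<-inInterval n {a} {b} a≤b = begin
      ∑< n (𝟙 ∘ inInterval a b)
    ≡⟨ m+n∸n≡m _ (∑< n (λ x → 𝟙 (x <ᵇ a))) ⟨
      ∑< n (𝟙 ∘ inInterval a b) + ∑< n (λ x → 𝟙 (x <ᵇ a)) ∸ ∑< n (λ x → 𝟙 (x <ᵇ a))
    ≡⟨ cong (_∸ ∑< n (λ x → 𝟙 (x <ᵇ a))) (trans (∑<-cong n (λ x _ → sym (𝟙-inInterval x a≤b))) (∑<-distrib-+ n _ _)) ⟨
      ∑< n (λ x → 𝟙 (x <ᵇ b)) ∸ ∑< n (λ x → 𝟙 (x <ᵇ a))
    ≡⟨ cong₂ _∸_ (∑<-<ᵇ n b) (∑<-<ᵇ n a) ⟩
      n ⊓ b ∸ n ⊓ a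
    ∎
    where open ≡-Reasoning

  initial : ∀ n → ℕ → Subset n
  initial n k = toSubset n (_<ᵇ k)

  interval : ∀ n → ℕ → ℕ → Subset n
  interval n a b = toSubset n (inInterval a b)

  ∣initial∣ : ∀ {n k} → k ≤ n → ∣ initial n k ∣ ≡ k
  ∣initial∣ {n} {k} k≤n = trans (∣toSubset∣ n (_<ᵇ k)) (trans (∑<-<ᵇ n k) (m≥n⇒m⊓n≡n k≤n))

  ∣interval∣ : ∀ {n a b} → a ≤ b → b ≤ n → ∣ interval n a b ∣ ≡ b ∸ a
  ∣interval∣ {n} {a} {b} a≤b b≤n = begin
      ∣ interval n a b ∣
    ≡⟨ trans (∣toSubset∣ n (inInterval a b)) (∑<-inInterval n a≤b) ⟩
      n ⊓ b ∸ n ⊓ a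
    ≡⟨ cong₂ _∸_ (m≥n⇒m⊓n≡n b≤n) (m≥n⇒m⊓n≡n (≤-trans a≤b b≤n)) ⟩
      b ∸ a
    ∎
    where open ≡-Reasoning

  initial-∪-interval : ∀ n {k b} → k ≤ b → initial n k ∪ interval n k b ≡ initial n b
  initial-∪-interval n {k} {b} k≤b =
    trans (toSubset-∪ n (_<ᵇ k) (inInterval k b)) (toSubset-cong n (λ x _ → pointwise x))
    where
    pointwise : ∀ x → (x <ᵇ k) ∨ inInterval k b x ≡ (x <ᵇ b)
    pointwise x with x <ᵇ k | <ᵇ-reflects-< x k | x <ᵇ b | <ᵇ-reflects-< x b
    ... | true | ofʸ x<k | false | ofⁿ x≮b = ⊥-elim (x≮b (<-≤-trans x<k k≤b))
    ... | true | _ | true | _ = refl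
    ... | false | _ | true | _ = refl
    ... | false | _ | false | _ = refl

  window : ∀ n (t s : ℕ) → Subset n
  window n t s = if s + s <ᵇ t then initial n s else interval n (t ∸ s) t

  ∣window∣ : ∀ {n t s} → t ≤ n → s ≤ t → ∣ window n t s ∣ ≡ s
  ∣window∣ {n} {t} {s} t≤n s≤t with s + s <ᵇ t
  ... | true = ∣initial∣ (≤-trans s≤t t≤n)
  ... | false = trans (∣interval∣ (m∸n≤m t s) t≤n) (m∸[m∸n]≡n s≤t)

  window-complement : ∀ n {t k} → k + k < t → window n t k ∪ window n t (t ∸ k) ≡ initial n t
  window-complement n {t} {k} 2k<t
    with k + k <ᵇ t | <ᵇ-reflects-< (k + k) t | (t ∸ k) + (t ∸ k) <ᵇ t | <ᵇ-reflects-< ((t ∸ k) + (t ∸ k)) t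
  ... | false | ofⁿ 2k≮t | _ | _ = ⊥-elim (2k≮t 2k<t)
  ... | true | _ | true | ofʸ 2[t∸k]<t = ⊥-elim (<-asym 2[t∸k]<t t<2[t∸k])
    where
    k≤t : k ≤ t
    k≤t = ≤-trans (m≤m+n k k) (<⇒≤ 2k<t)
    t<2[t∸k] : t < (t ∸ k) + (t ∸ k)
    t<2[t∸k] = +-cancelʳ-< (k + k) t _ (begin-strict
        t + (k + k)
      <⟨ +-monoʳ-< t 2k<t ⟩
        t + t
      ≡⟨ cong₂ _+_ (m∸n+n≡m k≤t) (m∸n+n≡m k≤t) ⟨
        (t ∸ k + k) + (t ∸ k + k)
      ≡⟨ +-interchange (t ∸ k) k (t ∸ k) k ⟩
        (t ∸ k) + (t ∸ k) + (k + k)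
      ∎)
      where open ≤-Reasoning
  ... | true | _ | false | _ = begin
      initial n k ∪ interval n (t ∸ (t ∸ k)) t
    ≡⟨ cong (λ a → initial n k ∪ interval n a t) (m∸[m∸n]≡n k≤t) ⟩
      initial n k ∪ interval n k t
    ≡⟨ initial-∪-interval n k≤t ⟩
      initial n t
    ∎
    where
    open ≡-Reasoning
    k≤t : k ≤ t
    k≤t = ≤-trans (m≤m+n k k) (<⇒≤ 2k<t)

  IsUnionᵇ : ∀ {n} → ℕ → (Subset n → Bool) → Set
  IsUnionᵇ w g = ∀ W W' → T (g W) → T (g W') → ∣ W ∪ W' ∣ ≤ w

  complementary-windows : ∀ {n w t k} (g : Subset n → Bool) → IsUnionᵇ w g → w < t → t ≤ n → k + k < t →
    𝟙 (g (window n t k)) + 𝟙 (g (window n t (t ∸ k))) ≤ 1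
  complementary-windows {n} {w} {t} {k} g union w<t t≤n 2k<t = 𝟙-exclusive _ _ λ gW gW' →
    <⇒≱ w<t (subst (_≤ w) (trans (cong ∣_∣ (window-complement n {t} {k} 2k<t)) (∣initial∣ t≤n)) (union _ _ gW gW'))

  windows-bound : ∀ n ℓ (g : Subset n → Bool) → suc (ℓ + ℓ) ≤ n → IsUnionᵇ (ℓ + ℓ) g →
    ∑< (suc (ℓ + ℓ)) (λ s → 𝟙 (g (window n (suc (ℓ + ℓ)) s))) ≤ suc ℓ
  windows-bound n ℓ g t≤n union = begin
      y 0 + ∑< (ℓ + ℓ) (y ∘ suc)
    ≡⟨ cong (y 0 +_) (∑<-fold ℓ (y ∘ suc)) ⟩
      y 0 + ∑< ℓ (λ i → y (suc i) + y (suc (ℓ + ℓ ∸ suc i)))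
    ≤⟨ +-mono-≤ (𝟙≤1 (g (window n t 0))) (∑<-mono-≤ ℓ pair) ⟩
      1 + ∑< ℓ (const 1)
    ≡⟨ cong suc (trans (∑<-const ℓ 1) (*-identityʳ ℓ)) ⟩
      suc ℓ
    ∎
    where
    open ≤-Reasoning
    t : ℕ
    t = suc (ℓ + ℓ)
    y : ℕ → ℕ
    y s = 𝟙 (g (window n t s))
    pair : ∀ i → i < ℓ → y (suc i) + y (suc (ℓ + ℓ ∸ suc i)) ≤ 1
    pair i i<ℓ = subst (λ s → y (suc i) + y s ≤ 1) (+-∸-assoc 1 (≤-trans i<ℓ (m≤m+n ℓ ℓ)))
      (complementary-windows {k = suc i} g union ≤-refl t≤n (s≤s (+-mono-≤ i<ℓ i<ℓ)))

  -- Arcs of the cycle and Katona's lemma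

  module _ (n ℓ : ℕ) where

    -- The arc {j, j + 1, …, j + ℓ − 1} of the cycle ℤ/n: the part j + ℓ − n that wraps
    -- around is the initial segment [0, j + ℓ ∸ n).
    inArc : ℕ → ℕ → Bool
    inArc j x = inInterval j (j + ℓ) x ∨ (x <ᵇ j + ℓ ∸ n)

    arc : ℕ → Subset n
    arc j = toSubset n (inArc j)

    inArc⇒ : ∀ j x → T (inArc j x) → (j ≤ x × x < j + ℓ) ⊎ (x + n < j + ℓ)
    inArc⇒ j x x∈arc = Sum.map (inInterval⇒ x) (m<o∸n⇒m+n<o ∘ <ᵇ⇒< x (j + ℓ ∸ n)) (Equivalence.to T-∨ x∈arc)

    ∣arc∣ : ∀ {j} → j < n → ℓ ≤ n → ∣ arc j ∣ ≡ ℓ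
    ∣arc∣ {j} j<n ℓ≤n = begin
        ∣ arc j ∣
      ≡⟨ ∣toSubset∣ n (inArc j) ⟩
        ∑< n (𝟙 ∘ inArc j)
      ≡⟨ ∑<-cong n (λ x _ → 𝟙-∨ (inInterval j (j + ℓ) x) _ (wrapped-disjoint x)) ⟩
        ∑< n (λ x → 𝟙 (inInterval j (j + ℓ) x) + 𝟙 (x <ᵇ j + ℓ ∸ n))
      ≡⟨ ∑<-distrib-+ n _ _ ⟩
        ∑< n (𝟙 ∘ inInterval j (j + ℓ)) + ∑< n (λ x → 𝟙 (x <ᵇ j + ℓ ∸ n))
      ≡⟨ cong₂ _+_ (∑<-inInterval n (m≤m+n j ℓ)) (∑<-<ᵇ n (j + ℓ ∸ n)) ⟩
        (n ⊓ (j + ℓ) ∸ n ⊓ j) + n ⊓ (j + ℓ ∸ n)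
      ≡⟨ cong₂ (λ a b → n ⊓ (j + ℓ) ∸ a + b) (m≥n⇒m⊓n≡n (<⇒≤ j<n)) (m≥n⇒m⊓n≡n wrap≤n) ⟩
        (n ⊓ (j + ℓ) ∸ j) + (j + ℓ ∸ n)
      ≡⟨ lengths (≤-<-connex (j + ℓ) n) ⟩
        ℓ
      ∎
      where
      open ≡-Reasoning
      wrap≤n : j + ℓ ∸ n ≤ n
      wrap≤n = m≤n+o⇒m∸n≤o (j + ℓ) n (+-mono-≤ (<⇒≤ j<n) ℓ≤n)
      wrapped-disjoint : ∀ x → T (inInterval j (j + ℓ) x) → T (x <ᵇ j + ℓ ∸ n) → ⊥
      wrapped-disjoint x x∈[j,j+ℓ[ x<wrap =
        <⇒≱ (<ᵇ⇒< x (j + ℓ ∸ n) x<wrap) (≤-trans wrap≤j (proj₁ (inInterval⇒ {j} {j + ℓ} x x∈[j,j+ℓ[)))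
        where
        wrap≤j : j + ℓ ∸ n ≤ j
        wrap≤j = m≤n+o⇒m∸n≤o (j + ℓ) n (≤-trans (+-monoʳ-≤ j ℓ≤n) (≤-reflexive (+-comm j n)))
      lengths : (j + ℓ ≤ n) ⊎ (n < j + ℓ) → (n ⊓ (j + ℓ) ∸ j) + (j + ℓ ∸ n) ≡ ℓ
      lengths (inj₁ j+ℓ≤n) rewrite m≥n⇒m⊓n≡n j+ℓ≤n | m≤n⇒m∸n≡0 j+ℓ≤n = trans (+-identityʳ _) (m+n∸m≡n j ℓ)
      lengths (inj₂ n<j+ℓ) rewrite m≤n⇒m⊓n≡m (<⇒≤ n<j+ℓ) = +-cancelˡ-≡ j _ _ (begin
          j + ((n ∸ j) + (j + ℓ ∸ n))
        ≡⟨ +-assoc j (n ∸ j) _ ⟨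
          j + (n ∸ j) + (j + ℓ ∸ n)
        ≡⟨ cong (_+ (j + ℓ ∸ n)) (m+[n∸m]≡n (<⇒≤ j<n)) ⟩
          n + (j + ℓ ∸ n)
        ≡⟨ m+[n∸m]≡n (<⇒≤ n<j+ℓ) ⟩
          j + ℓ
        ∎)

    disjoint-arcs : ∀ {j j'} x → j + ℓ ≤ j' → j' + ℓ ≤ j + n → j' < n → T (inArc j x) → T (inArc j' x) → ⊥
    disjoint-arcs {j} {j'} x j+ℓ≤j' j'+ℓ≤j+n j'<n x∈arc x∈arc' = separated (inArc⇒ j x x∈arc) (inArc⇒ j' x x∈arc')
      where
      separated : (j ≤ x × x < j + ℓ) ⊎ (x + n < j + ℓ) → (j' ≤ x × x < j' + ℓ) ⊎ (x + n < j' + ℓ) → ⊥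
      separated (inj₁ (_ , x<j+ℓ)) (inj₁ (j'≤x , _)) = <⇒≱ (<-≤-trans x<j+ℓ j+ℓ≤j') j'≤x
      separated (inj₁ (j≤x , _)) (inj₂ x+n<j'+ℓ) = <⇒≱ (<-≤-trans x+n<j'+ℓ j'+ℓ≤j+n) (+-monoˡ-≤ n j≤x)
      separated (inj₂ x+n<j+ℓ) (inj₁ (j'≤x , _)) = <⇒≱ x+n<j+ℓ (≤-trans j+ℓ≤j' (≤-trans j'≤x (m≤m+n x n)))
      separated (inj₂ x+n<j+ℓ) (inj₂ _) = <⇒≱ j'<n (≤-trans (m≤n+m n x) (≤-trans (<⇒≤ x+n<j+ℓ) j+ℓ≤j'))

    ∣arc∪arc∣ : ∀ {j j'} → j + ℓ ≤ j' → j' + ℓ ≤ j + n → j' < n → ℓ ≤ n → ∣ arc j ∪ arc j' ∣ ≡ ℓ + ℓ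
    ∣arc∪arc∣ {j} {j'} j+ℓ≤j' j'+ℓ≤j+n j'<n ℓ≤n = begin
        ∣ arc j ∪ arc j' ∣
      ≡⟨ cong ∣_∣ (toSubset-∪ n (inArc j) (inArc j')) ⟩
        ∣ toSubset n (λ x → inArc j x ∨ inArc j' x) ∣
      ≡⟨ ∣toSubset∣ n _ ⟩
        ∑< n (λ x → 𝟙 (inArc j x ∨ inArc j' x))
      ≡⟨ ∑<-cong n (λ x _ → 𝟙-∨ (inArc j x) (inArc j' x) (disjoint-arcs x j+ℓ≤j' j'+ℓ≤j+n j'<n)) ⟩
        ∑< n (λ x → 𝟙 (inArc j x) + 𝟙 (inArc j' x))
      ≡⟨ ∑<-distrib-+ n _ _ ⟩
        ∑< n (𝟙 ∘ inArc j) + ∑< n (𝟙 ∘ inArc j')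
      ≡⟨ cong₂ _+_ (∣toSubset∣ n (inArc j)) (∣toSubset∣ n (inArc j')) ⟨
        ∣ arc j ∣ + ∣ arc j' ∣
      ≡⟨ cong₂ _+_ (∣arc∣ (≤-<-trans (≤-trans (m≤m+n j ℓ) j+ℓ≤j') j'<n) ℓ≤n) (∣arc∣ j'<n ℓ≤n) ⟩
        ℓ + ℓ
      ∎
      where open ≡-Reasoning

  equal-offsets⇒apart : ∀ {m n ℓ q j j'} → ℓ + ℓ ≤ n → q + ℓ ≡ m + n → m ≤ j → q ≤ j' → j ∸ m ≡ j' ∸ q →
                        j + ℓ ≤ j' × j' + ℓ ≤ j + n
  equal-offsets⇒apart {m} {n} {ℓ} {q} {j} {j'} 2ℓ≤n q+ℓ≡m+n m≤j q≤j' same = j+ℓ≤j' , j'+ℓ≤j+n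
    where
    a : ℕ
    a = j ∸ m
    j≡m+a : j ≡ m + a
    j≡m+a = sym (m+[n∸m]≡n m≤j)
    j'≡q+a : j' ≡ q + a
    j'≡q+a = trans (sym (m+[n∸m]≡n q≤j')) (cong (q +_) (sym same))
    m+ℓ≤q : m + ℓ ≤ q
    m+ℓ≤q = +-cancelʳ-≤ ℓ (m + ℓ) q (subst (m + ℓ + ℓ ≤_) (sym q+ℓ≡m+n)
      (subst (_≤ m + n) (sym (+-assoc m ℓ ℓ)) (+-monoʳ-≤ m 2ℓ≤n)))
    j+ℓ≤j' : j + ℓ ≤ j'
    j+ℓ≤j' = begin
        j + ℓ       ≡⟨ cong (_+ ℓ) j≡m+a ⟩
        m + a + ℓ   ≡⟨ x+y+z≡x+z+y m a ℓ ⟩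
        m + ℓ + a   ≤⟨ +-monoˡ-≤ a m+ℓ≤q ⟩
        q + a       ≡⟨ j'≡q+a ⟨
        j'          ∎
      where open ≤-Reasoning
    j'+ℓ≤j+n : j' + ℓ ≤ j + n
    j'+ℓ≤j+n = ≤-reflexive (begin
        j' + ℓ      ≡⟨ cong (_+ ℓ) j'≡q+a ⟩
        q + a + ℓ   ≡⟨ x+y+z≡x+z+y q a ℓ ⟩
        q + ℓ + a   ≡⟨ cong (_+ a) q+ℓ≡m+n ⟩
        m + n + a   ≡⟨ x+y+z≡x+z+y m n a ⟩
        m + a + n   ≡⟨ cong (_+ n) j≡m+a ⟨
        j + n       ∎)
      where open ≡-Reasoning

  -- Katona's cycle lemma, for the arcs of length ℓ of the n-cycle whose starts satisfy P;
  -- for j ≤ j' the arcs starting at j and j' are disjoint iff j + ℓ ≤ j' and j' + ℓ ≤ j + n.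
  -- Let m be the first selected start. Every other selected arc meets arc m, so it starts
  -- in [m, m + ℓ) or in [q, m + n) with q = m + n ∸ ℓ; its offset inside that block is
  -- injective on selected arcs, because equal offsets in the two blocks give disjoint arcs.
  katona : ∀ n ℓ (P : ℕ → Bool) → ℓ + ℓ ≤ n →
    (∀ j j' → j' < n → T (P j) → T (P j') → j + ℓ ≤ j' → j' + ℓ ≤ j + n → ⊥) → ∑< n (𝟙 ∘ P) ≤ ℓ
  katona n ℓ P 2ℓ≤n intersecting with least n P
  ... | inj₁ none = ≤-trans (≤-reflexive (∑<-none n P none)) z≤n
  ... | inj₂ (m , m<n , Pm , below) = ∑<-≤-injection n ℓ P offset offset<ℓ offset-injective
    where
    q : ℕ
    q = m + n ∸ ℓ
    q+ℓ≡m+n : q + ℓ ≡ m + n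
    q+ℓ≡m+n = m∸n+n≡m (≤-trans (≤-trans (m≤m+n ℓ ℓ) 2ℓ≤n) (m≤n+m n m))

    offset : ℕ → ℕ
    offset j = if j <ᵇ m + ℓ then j ∸ m else j ∸ q

    early : ∀ {j} → T (P j) → m ≤ j
    early Pj = ≮⇒≥ (λ j<m → below _ j<m Pj)

    late : ∀ {j} → j < n → T (P j) → m + ℓ ≤ j → q < j
    late {j} j<n Pj m+ℓ≤j = +-cancelʳ-< ℓ q j
      (subst (_< j + ℓ) (sym q+ℓ≡m+n) (≰⇒> (intersecting m j j<n Pm Pj m+ℓ≤j)))

    offset<ℓ : ∀ j → j < n → T (P j) → offset j < ℓ
    offset<ℓ j j<n Pj with j <ᵇ m + ℓ | <ᵇ-reflects-< j (m + ℓ)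
    ... | true | ofʸ j<m+ℓ = ∸-<-offset (early Pj) j<m+ℓ
    ... | false | ofⁿ j≮m+ℓ = ∸-<-offset (<⇒≤ (late j<n Pj (≮⇒≥ j≮m+ℓ)))
      (subst (j <_) (sym q+ℓ≡m+n) (<-≤-trans j<n (m≤n+m n m)))

    crossing : ∀ {j j'} → j' < n → T (P j) → T (P j') → m + ℓ ≤ j' → j ∸ m ≡ j' ∸ q → ⊥
    crossing {j} {j'} j'<n Pj Pj' m+ℓ≤j' same = intersecting j j' j'<n Pj Pj' (proj₁ apart) (proj₂ apart)
      where
      apart : j + ℓ ≤ j' × j' + ℓ ≤ j + n
      apart = equal-offsets⇒apart 2ℓ≤n q+ℓ≡m+n (early Pj) (<⇒≤ (late j'<n Pj' m+ℓ≤j')) same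

    offset-injective : ∀ j j' → j < n → j' < n → T (P j) → T (P j') → offset j ≡ offset j' → j ≡ j'
    offset-injective j j' j<n j'<n Pj Pj' same
      with j <ᵇ m + ℓ | <ᵇ-reflects-< j (m + ℓ) | j' <ᵇ m + ℓ | <ᵇ-reflects-< j' (m + ℓ)
    ... | true | _ | true | _ = ∸-cancelʳ-≡ (early Pj) (early Pj') same
    ... | false | ofⁿ j≮ | false | ofⁿ j'≮ =
      ∸-cancelʳ-≡ (<⇒≤ (late j<n Pj (≮⇒≥ j≮))) (<⇒≤ (late j'<n Pj' (≮⇒≥ j'≮))) same
    ... | true | _ | false | ofⁿ j'≮ = ⊥-elim (crossing j'<n Pj Pj' (≮⇒≥ j'≮) same)
    ... | false | ofⁿ j≮ | true | _ = ⊥-elim (crossing j<n Pj' Pj (≮⇒≥ j≮) (sym same))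

  arcs-bound : ∀ n ℓ' (g : Subset n → Bool) → suc ℓ' + suc ℓ' ≤ n → IsUnionᵇ (ℓ' + suc ℓ') g →
    ∑< n (λ j → 𝟙 (g (arc n (suc ℓ') j))) ≤ suc ℓ'
  arcs-bound n ℓ' g 2ℓ≤n union = katona n ℓ (g ∘ arc n ℓ) 2ℓ≤n intersecting
    where
    ℓ : ℕ
    ℓ = suc ℓ'
    intersecting : ∀ j j' → j' < n → T (g (arc n ℓ j)) → T (g (arc n ℓ j')) → j + ℓ ≤ j' → j' + ℓ ≤ j + n → ⊥
    intersecting j j' j'<n gj gj' j+ℓ≤j' j'+ℓ≤j+n = <⇒≱ ≤-refl
      (subst (_≤ ℓ' + ℓ) (∣arc∪arc∣ n ℓ j+ℓ≤j' j'+ℓ≤j+n j'<n (≤-trans (m≤m+n ℓ ℓ) 2ℓ≤n)) (union _ _ gj gj'))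

  cyclicWindow : ∀ n ℓ → ℕ → ℕ → Subset n
  cyclicWindow n ℓ s j = if does (s ≟ ℓ) then arc n ℓ j else window n (ℓ + ℓ) s

  cyclicWindow-≡ : ∀ n ℓ j → cyclicWindow n ℓ ℓ j ≡ arc n ℓ j
  cyclicWindow-≡ n ℓ j = cong (if_then arc n ℓ j else window n (ℓ + ℓ) ℓ) (dec-true (ℓ ≟ ℓ) refl)

  cyclicWindow-≢ : ∀ n {ℓ s} j → s ≢ ℓ → cyclicWindow n ℓ s j ≡ window n (ℓ + ℓ) s
  cyclicWindow-≢ n {ℓ} {s} j s≢ℓ = cong (if_then arc n ℓ j else window n (ℓ + ℓ) s) (dec-false (s ≟ ℓ) s≢ℓ)

  cyclicWindows-bound : ∀ n ℓ' (g : Subset n → Bool) → suc ℓ' + suc ℓ' ≤ n → IsUnionᵇ (ℓ' + suc ℓ') g →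
    ∑< (suc ℓ' + suc ℓ') (λ s → ∑< n (λ j → 𝟙 (g (cyclicWindow n (suc ℓ') s j)))) ≤ n * suc ℓ' + suc ℓ'
  cyclicWindows-bound n ℓ' g 2ℓ≤n union = begin
      Y 0 + ∑< (ℓ' + ℓ) (Y ∘ suc)
    ≡⟨ cong (λ m → Y 0 + ∑< m (Y ∘ suc)) (+-suc ℓ' ℓ') ⟩
      Y 0 + ∑< (suc (ℓ' + ℓ')) (Y ∘ suc)
    ≡⟨ cong (Y 0 +_) (∑<-fold-odd ℓ' (Y ∘ suc)) ⟩
      Y 0 + (Y ℓ + ∑< ℓ' (λ i → Y (suc i) + Y (suc (ℓ' + ℓ' ∸ i))))
    ≤⟨ +-mono-≤ Y0≤n (+-mono-≤ Yℓ≤ℓ (∑<-mono-≤ ℓ' pair)) ⟩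
      n + (ℓ + ∑< ℓ' (const n))
    ≡⟨ cong (λ m → n + (ℓ + m)) (∑<-const ℓ' n) ⟩
      n + (ℓ + ℓ' * n)
    ≡⟨ rearrange n ℓ' ⟩
      n * ℓ + ℓ
    ∎
    where
    open ≤-Reasoning
    ℓ : ℕ
    ℓ = suc ℓ'
    y : ℕ → ℕ
    y s = 𝟙 (g (window n (ℓ + ℓ) s))
    Y : ℕ → ℕ
    Y s = ∑< n (λ j → 𝟙 (g (cyclicWindow n ℓ s j)))
    rearrange : ∀ n ℓ' → n + (suc ℓ' + ℓ' * n) ≡ n * suc ℓ' + suc ℓ'
    rearrange = solve-∀

    Y-window : ∀ s → s ≢ ℓ → Y s ≡ n * y s
    Y-window s s≢ℓ = trans (∑<-cong n (λ j _ → cong (𝟙 ∘ g) (cyclicWindow-≢ n j s≢ℓ))) (∑<-const n (y s))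

    Y0≤n : Y 0 ≤ n
    Y0≤n = begin
      Y 0       ≡⟨ Y-window 0 (λ ()) ⟩
      n * y 0   ≤⟨ *-monoʳ-≤ n (𝟙≤1 (g (window n (ℓ + ℓ) 0))) ⟩
      n * 1     ≡⟨ *-identityʳ n ⟩
      n         ∎

    Yℓ≤ℓ : Y ℓ ≤ ℓ
    Yℓ≤ℓ = ≤-trans (≤-reflexive (∑<-cong n (λ j _ → cong (𝟙 ∘ g) (cyclicWindow-≡ n ℓ j))))
      (arcs-bound n ℓ' g 2ℓ≤n union)

    pair : ∀ i → i < ℓ' → Y (suc i) + Y (suc (ℓ' + ℓ' ∸ i)) ≤ n
    pair i i<ℓ' = begin
        Y (suc i) + Y (suc (ℓ' + ℓ' ∸ i))
      ≡⟨ cong₂ _+_ (Y-window (suc i) (<⇒≢ (s<s i<ℓ'))) (Y-window (suc (ℓ' + ℓ' ∸ i)) (>⇒≢ ℓ<)) ⟩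
        n * y (suc i) + n * y (suc (ℓ' + ℓ' ∸ i))
      ≡⟨ *-distribˡ-+ n (y (suc i)) _ ⟨
        n * (y (suc i) + y (suc (ℓ' + ℓ' ∸ i)))
      ≤⟨ *-monoʳ-≤ n (subst (λ s → y (suc i) + y s ≤ 1) complement
           (complementary-windows {k = suc i} g union ≤-refl 2ℓ≤n (+-mono-< (s<s i<ℓ') (s<s i<ℓ')))) ⟩
        n * 1
      ≡⟨ *-identityʳ n ⟩
        n
      ∎
      where
      i≤2ℓ' : i ≤ ℓ' + ℓ'
      i≤2ℓ' = ≤-trans (<⇒≤ i<ℓ') (m≤m+n ℓ' ℓ')
      ℓ< : ℓ < suc (ℓ' + ℓ' ∸ i)
      ℓ< = s<s (begin-strict
        ℓ'               <⟨ m<m+n ℓ' (m<n⇒0<n∸m i<ℓ') ⟩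
        ℓ' + (ℓ' ∸ i)    ≡⟨ +-∸-assoc ℓ' (<⇒≤ i<ℓ') ⟨
        ℓ' + ℓ' ∸ i      ∎)
      complement : ℓ' + ℓ ∸ i ≡ suc (ℓ' + ℓ' ∸ i)
      complement = trans (cong (_∸ i) (+-suc ℓ' ℓ')) (+-∸-assoc 1 i≤2ℓ')

  IsUnion⇒∣F∣≤w : ∀ {n w} {𝓕 : List (Subset n)} → IsUnion w 𝓕 → ∀ F → F ∈ 𝓕 → ∣ F ∣ ≤ w
  IsUnion⇒∣F∣≤w {w = w} union F F∈𝓕 = subst (_≤ w) (cong ∣_∣ (∪-idem F)) (All.lookup (All.lookup union F∈𝓕) F∈𝓕)

  IsUnion⇒IsUnionᵇ : ∀ {n w} {𝓕 : List (Subset n)} → IsUnion w 𝓕 → ∀ π → IsUnionᵇ w (inImage 𝓕 π)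
  IsUnion⇒IsUnionᵇ {w = w} {𝓕} union π W W' W∈ W'∈
    with find (any⁻ _ 𝓕 W∈) | find (any⁻ _ 𝓕 W'∈)
  ... | F , F∈𝓕 , πF≡W | F' , F'∈𝓕 , πF'≡W' = begin
      ∣ W ∪ W' ∣
    ≡⟨ cong₂ (λ A B → ∣ A ∪ B ∣) (T-does⇒ (permute π F ≟ˢ W) πF≡W) (T-does⇒ (permute π F' ≟ˢ W') πF'≡W') ⟨
      ∣ permute π F ∪ permute π F' ∣
    ≡⟨ cong ∣_∣ (permute-zipWith _∨_ π F F') ⟨
      ∣ permute π (F ∪ F') ∣
    ≡⟨ ∣permute∣ π (F ∪ F') ⟩
      ∣ F ∪ F' ∣
    ≤⟨ All.lookup (All.lookup union F∈𝓕) F'∈𝓕 ⟩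
      w
    ∎
    where open ≤-Reasoning

  weightSum-even : ∀ n ℓ (𝓕 : List (Subset n)) → suc (ℓ + ℓ) ≤ n → Unique 𝓕 → IsUnion (ℓ + ℓ) 𝓕 →
                   weightSum 𝓕 ≤ n ! * suc ℓ
  weightSum-even n ℓ 𝓕 2ℓ+1≤n unique union = subst (_≤ n ! * suc ℓ) (+-identityʳ (weightSum 𝓕))
    (weightSum-≤ n (suc (ℓ + ℓ)) 1 (suc ℓ) 𝓕 unique (λ F F∈𝓕 → s≤s (IsUnion⇒∣F∣≤w union F F∈𝓕))
      (λ s _ → window n (suc (ℓ + ℓ)) s) (λ s _ s<t _ → ∣window∣ 2ℓ+1≤n (<⇒≤ s<t))
      (λ π → subst (_≤ suc ℓ)
        (∑<-cong (suc (ℓ + ℓ)) {λ s → 𝟙 (inImage 𝓕 π (window n (suc (ℓ + ℓ)) s))} (λ s _ → sym (+-identityʳ _)))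
        (windows-bound n ℓ (inImage 𝓕 π) 2ℓ+1≤n (IsUnion⇒IsUnionᵇ union π))))

  weightSum-odd : ∀ n ℓ' (𝓕 : List (Subset n)) → suc ℓ' + suc ℓ' ≤ n → Unique 𝓕 → IsUnion (ℓ' + suc ℓ') 𝓕 →
                  n * weightSum 𝓕 ≤ n ! * (n * suc ℓ' + suc ℓ')
  weightSum-odd n ℓ' 𝓕 2ℓ≤n unique union =
    weightSum-≤ n (suc ℓ' + suc ℓ') n (n * suc ℓ' + suc ℓ') 𝓕 unique (λ F F∈𝓕 → s≤s (IsUnion⇒∣F∣≤w union F F∈𝓕))
      (cyclicWindow n (suc ℓ')) ∣cyclicWindow∣
      (λ π → cyclicWindows-bound n ℓ' (inImage 𝓕 π) 2ℓ≤n (IsUnion⇒IsUnionᵇ union π))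
    where
    ℓ : ℕ
    ℓ = suc ℓ'
    ∣cyclicWindow∣ : ∀ s j → s < ℓ + ℓ → j < n → ∣ cyclicWindow n ℓ s j ∣ ≡ s
    ∣cyclicWindow∣ s j s<2ℓ j<n with s ≟ ℓ
    ... | yes refl = trans (cong ∣_∣ (cyclicWindow-≡ n ℓ j)) (∣arc∣ n ℓ j<n (≤-trans (m≤m+n ℓ ℓ) 2ℓ≤n))
    ... | no s≢ℓ = trans (cong ∣_∣ (cyclicWindow-≢ n j s≢ℓ)) (∣window∣ 2ℓ≤n (<⇒≤ s<2ℓ))

  nCk*k![n∸k]!≡n! : ∀ {n k} → k ≤ n → (n C k) * (k ! * (n ∸ k) !) ≡ n !
  nCk*k![n∸k]!≡n! {n} {k} k≤n = trans (cong (_* (k ! * (n ∸ k) !)) (nCk≡n!/k![n-k]! k≤n))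
    (m/n*n≡m {{k !* (n ∸ k) !≢0}} (k![n∸k]!∣n! k≤n))

  toℚᵘ-/ : ∀ i d .{{_ : NonZero d}} → ℚ.toℚᵘ (i ℚ./ d) ℚᵘ.≃ i ℚᵘ./ d
  toℚᵘ-/ i (suc d) = ℚP.toℚᵘ-fromℚᵘ (mkℚᵘ i d)

  /-≃-/ : ∀ a b d d' .{{_ : NonZero d}} .{{_ : NonZero d'}} → a * d' ≡ d * b → ℤ.+ a ℚᵘ./ d ℚᵘ.≃ ℤ.+ b ℚᵘ./ d'
  /-≃-/ a b (suc d) (suc d') eq =
    *≡* (trans (sym (ℤP.pos-* a _)) (trans (cong ℤ.+_ (trans eq (*-comm (suc d) b))) (ℤP.pos-* b _)))

  /-≤-/ : ∀ a b d d' .{{_ : NonZero d}} .{{_ : NonZero d'}} → a * d' ≤ d * b → ℤ.+ a ℚᵘ./ d ℚᵘ.≤ ℤ.+ b ℚᵘ./ d'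
  /-≤-/ a b (suc d) (suc d') le =
    *≤* (subst₂ ℤ._≤_ (ℤP.pos-* a _) (ℤP.pos-* b _) (ℤ.+≤+ (≤-trans le (≤-reflexive (*-comm (suc d) b)))))

  /-+-/ : ∀ a b d .{{_ : NonZero d}} → ℤ.+ a ℚᵘ./ d ℚᵘ.+ ℤ.+ b ℚᵘ./ d ℚᵘ.≃ ℤ.+ (a + b) ℚᵘ./ d
  /-+-/ a b d@(suc _) = ℚᵘP.≃-trans (ℚᵘP.≃-reflexive (ℚᵘP./-cong numerators refl)) (ℚᵘP.*-cancelʳ-/ d)
    where
    numerators : ℤ.+ a ℤ.* ℤ.+ d ℤ.+ ℤ.+ b ℤ.* ℤ.+ d ≡ ℤ.+ (a + b) ℤ.* ℤ.+ d
    numerators = trans (sym (ℤP.*-distribʳ-+ (ℤ.+ d) (ℤ.+ a) (ℤ.+ b))) (cong (ℤ._* ℤ.+ d) (sym (ℤP.pos-+ a b)))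

  /1-+-/ : ∀ a b d .{{_ : NonZero d}} → ℤ.+ a ℚᵘ./ 1 ℚᵘ.+ ℤ.+ b ℚᵘ./ d ℚᵘ.≃ ℤ.+ (d * a + b) ℚᵘ./ d
  /1-+-/ a b d = ℚᵘP.≃-trans
    (ℚᵘP.+-congˡ (ℤ.+ b ℚᵘ./ d) (/-≃-/ a (d * a) 1 d (trans (*-comm a d) (sym (*-identityˡ (d * a))))))
    (/-+-/ (d * a) b d)

  module _ {n : ℕ} where

    private instance
      n!-nonZero : NonZero (n !)
      n!-nonZero = n !≢0

    binomNorm≃ : (𝓕 : List (Subset n)) → ℚ.toℚᵘ (binomNorm 𝓕) ℚᵘ.≃ ℤ.+ weightSum 𝓕 ℚᵘ./ n !
    binomNorm≃ [] = /-≃-/ 0 0 1 (n !) refl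
    binomNorm≃ (F ∷ 𝓕) = begin-equality
        ℚ.toℚᵘ (binomWeight F ℚ.+ binomNorm 𝓕)
      ≃⟨ ℚP.toℚᵘ-homo-+ (binomWeight F) (binomNorm 𝓕) ⟩
        ℚ.toℚᵘ (binomWeight F) ℚᵘ.+ ℚ.toℚᵘ (binomNorm 𝓕)
      ≃⟨ ℚᵘP.+-cong weight (binomNorm≃ 𝓕) ⟩
        ℤ.+ (∣ F ∣ ! * (n ∸ ∣ F ∣) !) ℚᵘ./ n ! ℚᵘ.+ ℤ.+ weightSum 𝓕 ℚᵘ./ n !
      ≃⟨ /-+-/ (∣ F ∣ ! * (n ∸ ∣ F ∣) !) (weightSum 𝓕) (n !) ⟩
        ℤ.+ weightSum (F ∷ 𝓕) ℚᵘ./ n !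
      ∎
      where
      open ℚᵘP.≤-Reasoning
      weight : ℚ.toℚᵘ (binomWeight F) ℚᵘ.≃ ℤ.+ (∣ F ∣ ! * (n ∸ ∣ F ∣) !) ℚᵘ./ n !
      weight = ℚᵘP.≃-trans (toℚᵘ-/ (ℤ.+ 1) (n C ∣ F ∣) ⦃ C-nonZero (∣p∣≤n F) ⦄)
        (/-≃-/ 1 _ (n C ∣ F ∣) (n !) ⦃ C-nonZero (∣p∣≤n F) ⦄
          (trans (*-identityˡ (n !)) (sym (nCk*k![n∸k]!≡n! (∣p∣≤n F)))))

    binomNorm-even : ∀ {w} ℓ (𝓕 : List (Subset n)) → w < n → Unique 𝓕 → IsUnion w 𝓕 → w ≡ 2 * ℓ →
                     binomNorm 𝓕 ℚ.≤ ℤ.+ (ℓ + 1) ℚ./ 1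
    binomNorm-even ℓ 𝓕 w<n unique union refl = ℚP.toℚᵘ-cancel-≤ (begin
        ℚ.toℚᵘ (binomNorm 𝓕)
      ≃⟨ binomNorm≃ 𝓕 ⟩
        ℤ.+ weightSum 𝓕 ℚᵘ./ n !
      ≤⟨ /-≤-/ (weightSum 𝓕) (ℓ + 1) (n !) 1 weightSum≤ ⟩
        ℤ.+ (ℓ + 1) ℚᵘ./ 1
      ≃⟨ toℚᵘ-/ (ℤ.+ (ℓ + 1)) 1 ⟨
        ℚ.toℚᵘ (ℤ.+ (ℓ + 1) ℚ./ 1)
      ∎)
      where
      open ℚᵘP.≤-Reasoning
      2ℓ≡ℓ+ℓ : 2 * ℓ ≡ ℓ + ℓ
      2ℓ≡ℓ+ℓ = cong (ℓ +_) (+-identityʳ ℓ)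
      weightSum≤ : weightSum 𝓕 * 1 ≤ n ! * (ℓ + 1)
      weightSum≤ = subst₂ _≤_ (sym (*-identityʳ (weightSum 𝓕))) (cong (n ! *_) (+-comm 1 ℓ))
        (weightSum-even n ℓ 𝓕 (subst (_< n) 2ℓ≡ℓ+ℓ w<n) unique (subst (λ w → IsUnion w 𝓕) 2ℓ≡ℓ+ℓ union))

    binomNorm-odd : ∀ {w} ℓ (𝓕 : List (Subset n)) (w<n : w < n) → Unique 𝓕 → IsUnion w 𝓕 → w + 1 ≡ 2 * ℓ →
                    binomNorm 𝓕 ℚ.≤ (ℤ.+ ℓ ℚ./ 1) ℚ.+ (ℤ.+ ℓ ℚ./ n) ⦃ >-nonZero (≤-<-trans z≤n w<n) ⦄
    binomNorm-odd {w} zero 𝓕 w<n unique union w+1≡0 = ⊥-elim (1+n≢0 (trans (+-comm 1 w) w+1≡0))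
    binomNorm-odd {w} (suc ℓ') 𝓕 w<n unique union w+1≡2ℓ = ℚP.toℚᵘ-cancel-≤ (begin
        ℚ.toℚᵘ (binomNorm 𝓕)
      ≃⟨ binomNorm≃ 𝓕 ⟩
        ℤ.+ weightSum 𝓕 ℚᵘ./ n !
      ≤⟨ /-≤-/ (weightSum 𝓕) (n * ℓ + ℓ) (n !) n weightSum≤ ⟩
        ℤ.+ (n * ℓ + ℓ) ℚᵘ./ n
      ≃⟨ /1-+-/ ℓ ℓ n ⟨
        ℤ.+ ℓ ℚᵘ./ 1 ℚᵘ.+ ℤ.+ ℓ ℚᵘ./ n
      ≃⟨ ℚᵘP.+-cong (toℚᵘ-/ (ℤ.+ ℓ) 1) (toℚᵘ-/ (ℤ.+ ℓ) n) ⟨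
        ℚ.toℚᵘ (ℤ.+ ℓ ℚ./ 1) ℚᵘ.+ ℚ.toℚᵘ (ℤ.+ ℓ ℚ./ n)
      ≃⟨ ℚP.toℚᵘ-homo-+ (ℤ.+ ℓ ℚ./ 1) (ℤ.+ ℓ ℚ./ n) ⟨
        ℚ.toℚᵘ ((ℤ.+ ℓ ℚ./ 1) ℚ.+ (ℤ.+ ℓ ℚ./ n))
      ∎)
      where
      open ℚᵘP.≤-Reasoning
      instance
        n-nonZero : NonZero n
        n-nonZero = >-nonZero (≤-<-trans z≤n w<n)
      ℓ : ℕ
      ℓ = suc ℓ'
      w≡2ℓ-1 : w ≡ ℓ' + ℓ
      w≡2ℓ-1 = suc-injective (trans (+-comm 1 w) (trans w+1≡2ℓ (cong (λ m → ℓ + m) (+-identityʳ ℓ))))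
      weightSum≤ : weightSum 𝓕 * n ≤ n ! * (n * ℓ + ℓ)
      weightSum≤ = subst (_≤ n ! * (n * ℓ + ℓ)) (*-comm n (weightSum 𝓕))
        (weightSum-odd n ℓ' 𝓕 (subst (_< n) w≡2ℓ-1 w<n) unique (subst (λ w → IsUnion w 𝓕) w≡2ℓ-1 union))

open import Data.Nat using (ℕ; _<_; _*_; z≤n; >-nonZero)
open import Data.Nat.Properties using (≤-<-trans)
open import Data.Fin.Subset using (Subset)
open import Data.List using (List)
open import Data.List.Relation.Unary.Unique.Propositional using (Unique)
open import Data.Integer using (+_)
open import Data.Rational using (_≤_; _+_; _/_)
open import Relation.Binary.PropositionalEquality using (_≡_)
open import Data.Product using (_×_; _,_)
open BinomialNorm using (binomNorm-even; binomNorm-odd)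

mainTheorem10 : (n w : ℕ) → (w<n : w < n) → (𝓕 : List (Subset n)) → Unique 𝓕 → IsUnion w 𝓕 →
  ((ℓ : ℕ) → w ≡ 2 * ℓ → binomNorm 𝓕 ≤ + (ℓ Data.Nat.+ 1) / 1)
  × ((ℓ : ℕ) → w Data.Nat.+ 1 ≡ 2 * ℓ → binomNorm 𝓕 ≤ (+ ℓ / 1) + (+ ℓ / n) {{>-nonZero (≤-<-trans z≤n w<n)}})
mainTheorem10 n w w<n 𝓕 unique union =
  (λ ℓ → binomNorm-even ℓ 𝓕 w<n unique union) , (λ ℓ → binomNorm-odd ℓ 𝓕 w<n unique union)
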